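{- Let $x,m$ be non-negative integers and let $1\le a_1<\dots<a_m\le 2m$ be integers. Then the region $Q_{x}((a_i)_{i=1}^{m})$ admits a lozenge tiling if and only if \[ |\{a_i\}_{i=1}^{m}\cap[2t]|\leq t\quad\text{for every } t=1,2,\dots,m, \] where $[2t]=\{1,2,\dots,2t\}$.
   Context: Work on the triangular lattice with unit side length and horizontal lattice lines; a lozenge is the union of two unit triangles sharing an edge, and a tiling is a covering of a region by lozenges without gaps or overlaps. The region $Q_x((a_i))$: using coordinates $(i,h)$ with $i$ twice the horizontal distance from a fixed vertical line and $h$ the height in rows, it is the region with $2m$ rows between heights $0$ and $2m$, top side the horizontal segment at height $2m$ from $i=1$ to $i=2x+1$ (length $x$), base the horizontal segment at height $0$ from $i=1$ to $i=2x+2m+1$ (length $x+m$), right side the straight segment from $(2x+1,2m)$ to $(2x+2m+1,0)$, and left side a vertical zigzag of $2m$ unit steps with vertices at $i=1$ at even heights and at $i=0$ at odd heights. Rows are numbered $1,\dots,2m$ from top to bottom; the rightmost unit triangle of each row is up-pointing, and the rightmost unit triangle of rows $a_1,\dots,a_m$ is removed. -}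

module Defs where

open import Data.Nat using (ℕ; zero; suc; _+_; _*_; _≤_; _<_; _≤?_)
open import Data.Nat.DivMod using (_%_)
open import Data.Fin using (Fin)
open import Data.List using (List; []; _∷_; filter; length; allFin)
open import Data.List.Relation.Unary.All using (All)
open import Data.Product using (Σ; _×_; _,_; proj₁; proj₂)
open import Data.Product.Properties using (≡-dec)
open import Data.Sum using (_⊎_)
open import Relation.Nullary using (¬_; Dec; yes; no)
open import Relation.Binary.PropositionalEquality using (_≡_)
import Data.Nat as ℕ

-- A unit triangle is addressed by (r , j):
--   r = row number counted from the top (rows of Q_x are r = 1 .. 2m),
--   j = i-coordinate of its centroid, i.e. twice the horizontal distance
--       from the fixed vertical line (the left zigzag lies between i=0 and i=1).
-- With the conventions of the paper the region's row r (height strip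
-- between heights 2m-r and 2m-r+1) is tiled by the triangles j = 1 .. 2x+r,
-- and triangle (r , j) is up-pointing iff j + r is even.
Cell : Set
Cell = ℕ × ℕ

-- Two unit triangles sharing an edge:
--  * horizontal neighbours in a row share a slanted edge;
--  * a down-pointing triangle (r+1 , j) (i.e. j + (r+1) odd, written (j + suc r) % 2 ≡ 1) shares its
--    horizontal top edge with the up-pointing triangle (r , j) above it.
data Adjacent : Cell → Cell → Set where
  horiz : ∀ {r j} → Adjacent (r , j) (r , suc j)
  vert  : ∀ {r j} → (j + suc r) % 2 ≡ 1 → Adjacent (r , j) (suc r , j)

Lozenge : Set
Lozenge = Σ (Cell × Cell) (λ p → Adjacent (proj₁ p) (proj₂ p))

cellsOf : Lozenge → Cell × Cell
cellsOf l = proj₁ l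

_≟C_ : (c d : Cell) → Dec (c ≡ d)
_≟C_ = ≡-dec ℕ._≟_ ℕ._≟_

covers : Cell → Lozenge → ℕ
covers c ((d , e) , _) with c ≟C d | c ≟C e
... | yes _ | yes _ = 2
... | yes _ | no _  = 1
... | no _  | yes _ = 1
... | no _  | no _  = 0

coverCount : Cell → List Lozenge → ℕ
coverCount c []       = 0
coverCount c (l ∷ ls) = covers c l + coverCount c ls

_∈Seq_ : ∀ {m} → ℕ → (Fin m → ℕ) → Set
_∈Seq_ {m} r a = Σ (Fin m) (λ i → a i ≡ r)

-- The region Q_x((a_i)_{i=1}^m) as a set of unit triangles:
-- rows 1..2m, row r consists of triangles j = 1 .. 2x + r, except that the
-- rightmost one (j = 2x + r, up-pointing) is removed when r is one of the a_i.
InQ : (x m : ℕ) → (Fin m → ℕ) → Cell → Set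
InQ x m a (r , j) =
  (1 ≤ r) × (r ≤ 2 * m) × (1 ≤ j) × (j ≤ 2 * x + r)
  × ¬ ((j ≡ 2 * x + r) × (r ∈Seq a))

IsTiling : (Cell → Set) → List Lozenge → Set
IsTiling R ls =
  All (λ l → R (proj₁ (cellsOf l)) × R (proj₂ (cellsOf l))) ls
  × (∀ c → R c → coverCount c ls ≡ 1)

Tileable : (Cell → Set) → Set
Tileable R = Σ (List Lozenge) (IsTiling R)

-- |{a_i} ∩ [2t]|  (the a_i are distinct, so counting indices suffices)
countUpTo : ∀ {m} → (Fin m → ℕ) → ℕ → ℕ
countUpTo {m} a t = length (filter (λ i → a i ≤? 2 * t) (allFin m))

module Submission where

-- Necessity: in a lozenge the up-pointing triangle lies in the same row as its down-pointing
-- partner or in the row just above it, so the top 2t rows of any tiled region contain at least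
-- as many up as down triangles.  In row r of Q_x, #up − #down = [r odd] − [r ∈ {a_i}]; summed
-- over the top 2t rows this is t − |{a_i} ∩ [2t]|, which must therefore be ≥ 0.
--
-- Sufficiency: writing C(r) = |{a_i} ∩ [r]|, the hypothesis gives C(r−1) + C(r) ≤ r.  Cut row r
-- after column r − C(r−1) − C(r).  Left of the cut, every up triangle is joined to the down
-- triangle below it, and these fill exactly the down triangles left of the cut in the next row;
-- right of the cut remain 2x + 2C(r−1) triangles, which are paired horizontally.

open import Defs
open import Data.Nat using (ℕ; _*_; _≤_; _<_)
open import Data.Fin using (Fin)
import Data.Fin as F
open import Data.Product using (_×_)
open import Function.Bundles using (_⇔_)

open import Algebra.Properties.CommutativeSemigroup using (interchange)
open import Data.Bool using (Bool; true; false; not; _xor_)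
import Data.Bool.Properties as Bool
import Data.Fin.Properties as FP
open import Data.List using (List; []; _∷_; _++_; filter; length; allFin)
open import Data.List.Properties using (filter-accept; filter-reject; filter-none; filter-all; length-tabulate)
open import Data.List.Membership.Propositional using (lose)
open import Data.List.Membership.Propositional.Properties using (∈-allFin)
open import Data.List.Relation.Unary.All using (All; []; _∷_)
import Data.List.Relation.Unary.All as All
open import Data.List.Relation.Unary.All.Properties using (++⁺)
open import Data.List.Relation.Unary.AllPairs using ([]; _∷_)
open import Data.List.Relation.Unary.Any using (here; there; satisfied)
import Data.List.Relation.Unary.Any as Any
open import Data.List.Relation.Unary.Unique.Propositional using (Unique)
open import Data.List.Relation.Unary.Unique.Propositional.Properties using (allFin⁺)
open import Data.Nat
open import Data.Nat.DivMod using (_%_)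
open import Data.Nat.Properties
open import Data.Nat.Tactic.RingSolver using (solve-∀)
open import Data.Product using (_,_; ∃; proj₁; proj₂)
open import Data.Sum using (_⊎_; inj₁; inj₂)
open import Function.Base using (_∘_)
open import Function.Bundles using (Equivalence; mk⇔)
import Function.Properties.Equivalence as ⇔
open import Relation.Binary using (tri<; tri≈; tri>)
open import Relation.Binary.PropositionalEquality
open import Relation.Nullary using (Dec; yes; no; ¬_; contradiction)
open import Relation.Nullary.Decidable using (_×-dec_; ¬?)
import Relation.Nullary.Decidable as Dec

-- Indicators and finite sums

bit : Bool → ℕ
bit true  = 1
bit false = 0

-- Defined by matching on the decision (not as a function of `does`), so that `with` on a
-- decision procedure also rewrites its indicator.
𝟙 : ∀ {ℓ} {P : Set ℓ} → Dec P → ℕ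
𝟙 (yes _) = 1
𝟙 (no _)  = 0

𝟙-≤1 : ∀ {ℓ} {P : Set ℓ} (d : Dec P) → 𝟙 d ≤ 1
𝟙-≤1 (yes _) = s≤s z≤n
𝟙-≤1 (no _)  = z≤n

𝟙-yes : ∀ {ℓ} {P : Set ℓ} (d : Dec P) → P → 𝟙 d ≡ 1
𝟙-yes (yes _) _ = refl
𝟙-yes (no ¬p) p = contradiction p ¬p

𝟙-no : ∀ {ℓ} {P : Set ℓ} (d : Dec P) → ¬ P → 𝟙 d ≡ 0
𝟙-no (yes p) ¬p = contradiction p ¬p
𝟙-no (no _)  _  = refl

𝟙-cong : ∀ {ℓ ℓ′} {P : Set ℓ} {Q : Set ℓ′} (d : Dec P) (e : Dec Q) → P ⇔ Q → 𝟙 d ≡ 𝟙 e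
𝟙-cong (yes p) e P⇔Q = sym (𝟙-yes e (Equivalence.to P⇔Q p))
𝟙-cong (no ¬p) e P⇔Q = sym (𝟙-no e (λ q → ¬p (Equivalence.from P⇔Q q)))

𝟙-mono : ∀ {ℓ ℓ′} {P : Set ℓ} {Q : Set ℓ′} (d : Dec P) (e : Dec Q) → (P → Q) → 𝟙 d ≤ 𝟙 e
𝟙-mono (yes p) e P→Q = ≤-reflexive (sym (𝟙-yes e (P→Q p)))
𝟙-mono (no _)  e P→Q = z≤n

sumBelow : ℕ → (ℕ → ℕ) → ℕ
sumBelow zero    f = 0
sumBelow (suc n) f = sumBelow n f + f n

syntax sumBelow n (λ i → e) = ∑[ i < n ] e

∑-cong : ∀ n {f g : ℕ → ℕ} → (∀ i → i < n → f i ≡ g i) → ∑[ i < n ] f i ≡ ∑[ i < n ] g i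
∑-cong zero    f≗g = refl
∑-cong (suc n) f≗g = cong₂ _+_ (∑-cong n (λ i i<n → f≗g i (m<n⇒m<1+n i<n))) (f≗g n ≤-refl)

∑-zero : ∀ n {f : ℕ → ℕ} → (∀ i → i < n → f i ≡ 0) → ∑[ i < n ] f i ≡ 0
∑-zero n {f} f≗0 = trans (∑-cong n {f} f≗0) (∑-const0 n)
  where
  ∑-const0 : ∀ n → ∑[ i < n ] 0 ≡ 0
  ∑-const0 zero    = refl
  ∑-const0 (suc n) = cong (_+ 0) (∑-const0 n)

∑-+ : ∀ n (f g : ℕ → ℕ) → ∑[ i < n ] (f i + g i) ≡ ∑[ i < n ] f i + ∑[ i < n ] g i
∑-+ zero    f g = refl
∑-+ (suc n) f g = begin
  ∑[ i < n ] (f i + g i) + (f n + g n)            ≡⟨ cong (_+ (f n + g n)) (∑-+ n f g) ⟩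
  ∑[ i < n ] f i + ∑[ i < n ] g i + (f n + g n)   ≡⟨ +-interchange (∑[ i < n ] f i) (∑[ i < n ] g i) (f n) (g n) ⟩
  ∑[ i < n ] f i + f n + (∑[ i < n ] g i + g n)   ∎
  where open ≡-Reasoning
        +-interchange = interchange +-commutativeSemigroup

∑-*ˡ : ∀ n k (f : ℕ → ℕ) → ∑[ i < n ] (k * f i) ≡ k * ∑[ i < n ] f i
∑-*ˡ zero    k f = sym (*-zeroʳ k)
∑-*ˡ (suc n) k f = trans (cong (_+ k * f n) (∑-*ˡ n k f)) (sym (*-distribˡ-+ k _ (f n)))

∑-extend : ∀ {n B} {f : ℕ → ℕ} → n ≤ B → (∀ i → n ≤ i → i < B → f i ≡ 0) → ∑[ i < B ] f i ≡ ∑[ i < n ] f i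
∑-extend {n} {zero}  n≤B f≗0 rewrite n≤0⇒n≡0 n≤B = refl
∑-extend {n} {suc B} {f} n≤B f≗0 with m≤n⇒m<n∨m≡n n≤B
... | inj₂ refl = refl
... | inj₁ n<1+B = trans (cong₂ _+_ (∑-extend (≤-pred n<1+B) (λ i n≤i i<B → f≗0 i n≤i (m<n⇒m<1+n i<B)))
                                    (f≗0 B (≤-pred n<1+B) ≤-refl))
                         (+-identityʳ _)

∑-point : ∀ n (f : ℕ → ℕ) k → k < n → (∀ i → i ≢ k → f i ≡ 0) → ∑[ i < n ] f i ≡ f k
∑-point n f k k<n f≗0 = begin
  ∑[ i < n ] f i                     ≡⟨ ∑-extend {f = f} k<n (λ i k<i i<n → f≗0 i (λ i≡k → <-irrefl (sym i≡k) k<i)) ⟩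
  ∑[ i < k ] f i + f k               ≡⟨ cong (_+ f k) (∑-zero k {f} (λ i i<k → f≗0 i (<⇒≢ i<k))) ⟩
  f k                                ∎
  where open ≡-Reasoning

∑-shift : ∀ n (f : ℕ → ℕ) → ∑[ i < suc n ] f i ≡ f 0 + ∑[ i < n ] f (suc i)
∑-shift zero    f = +-comm 0 (f 0)
∑-shift (suc n) f = trans (cong (_+ f (suc n)) (∑-shift n f)) (+-assoc (f 0) (∑[ i < n ] f (suc i)) (f (suc n)))

∑-alternating : ∀ n (g : ℕ → Bool) → (∀ i → g (suc i) ≡ not (g i)) → ∑[ i < n + n ] bit (g i) ≡ n
∑-alternating zero    g alt = refl
∑-alternating (suc n) g alt rewrite +-suc n n = begin
  S + bit (g (n + n)) + bit (g (suc (n + n)))    ≡⟨ cong (λ b → S + bit (g (n + n)) + bit b) (alt (n + n)) ⟩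
  S + bit (g (n + n)) + bit (not (g (n + n)))    ≡⟨ +-assoc S _ _ ⟩
  S + (bit (g (n + n)) + bit (not (g (n + n))))  ≡⟨ cong₂ _+_ (∑-alternating n g alt) (one-of (g (n + n))) ⟩
  n + 1                                          ≡⟨ +-comm n 1 ⟩
  suc n                                          ∎
  where
  open ≡-Reasoning
  S = ∑[ i < n + n ] bit (g i)
  one-of : ∀ b → bit b + bit (not b) ≡ 1
  one-of true  = refl
  one-of false = refl

∑-interval : ∀ {B L} (f : ℕ → ℕ) {P : ℕ → Set} (P? : ∀ j → Dec (P j)) →
             (∀ j → P j ⇔ (1 ≤ j × j ≤ L)) → L < B →
             ∑[ j < B ] (f j * 𝟙 (P? j)) ≡ ∑[ i < L ] f (suc i)
∑-interval {B} {L} f P? P⇔ L<B = begin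
  ∑[ j < B ] (f j * 𝟙 (P? j))                       ≡⟨ ∑-extend L<B (λ j L<j _ → outside j L<j) ⟩
  ∑[ j < suc L ] (f j * 𝟙 (P? j))                   ≡⟨ ∑-shift L (λ j → f j * 𝟙 (P? j)) ⟩
  f 0 * 𝟙 (P? 0) + ∑[ i < L ] (f (suc i) * 𝟙 (P? (suc i)))
    ≡⟨ cong₂ _+_ (trans (cong (f 0 *_) (𝟙-no (P? 0) (λ P0 → 1+n≰n (proj₁ (Equivalence.to (P⇔ 0) P0))))) (*-zeroʳ (f 0)))
                 (∑-cong L (λ i i<L → trans (cong (f (suc i) *_) (𝟙-yes (P? (suc i)) (Equivalence.from (P⇔ (suc i)) (s≤s z≤n , i<L))))
                                            (*-identityʳ (f (suc i))))) ⟩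
  ∑[ i < L ] f (suc i)                            ∎
  where
  open ≡-Reasoning
  outside : ∀ j → L < j → f j * 𝟙 (P? j) ≡ 0
  outside j L<j = trans (cong (f j *_) (𝟙-no (P? j) (λ Pj → <⇒≱ L<j (proj₂ (Equivalence.to (P⇔ j) Pj))))) (*-zeroʳ (f j))

-- Parity

odd : ℕ → Bool
odd zero    = false
odd (suc n) = not (odd n)

odd-+ : ∀ m n → odd (m + n) ≡ odd m xor odd n
odd-+ zero    n = refl
odd-+ (suc m) n rewrite odd-+ m n with odd m
... | true  = Bool.not-involutive (odd n)
... | false = refl

odd-double+ : ∀ n k → odd (n + n + k) ≡ odd k
odd-double+ n k rewrite odd-+ (n + n) k | odd-+ n n | Bool.xor-same (odd n) = refl

odd-2* : ∀ n → odd (2 * n) ≡ false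
odd-2* n = trans (cong odd (double n)) (odd-double+ n 0)
  where
  double : ∀ n → 2 * n ≡ n + n + 0
  double = solve-∀

odd-+suc : ∀ m n → odd (m + suc n) ≡ not (odd (m + n))
odd-+suc m n = cong odd (+-suc m n)

odd⇒%2≡1 : ∀ n → odd n ≡ true → n % 2 ≡ 1
odd⇒%2≡1 (suc zero)    _ = refl
odd⇒%2≡1 (suc (suc n)) o = odd⇒%2≡1 n (trans (sym (Bool.not-involutive (odd n))) o)

%2≡1⇒odd : ∀ n → n % 2 ≡ 1 → odd n ≡ true
%2≡1⇒odd (suc zero)    _ = refl
%2≡1⇒odd (suc (suc n)) h = trans (Bool.not-involutive (odd n)) (%2≡1⇒odd n h)

true≢false : true ≢ false
true≢false ()

half : ∀ n → ∃ λ k → n ≡ k + k ⊎ n ≡ suc (k + k)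
half zero = 0 , inj₁ refl
half (suc n) with half n
... | k , inj₁ refl = k , inj₂ refl
... | k , inj₂ refl = suc k , inj₁ (cong suc (sym (+-suc k k)))

m+m≤2*n⇒m≤n : ∀ {m n} → m + m ≤ 2 * n → m ≤ n
m+m≤2*n⇒m≤n {m} {n} m+m≤2n = *-cancelˡ-≤ 2 (subst (_≤ 2 * n) (cong (m +_) (sym (+-identityʳ m))) m+m≤2n)

-- Counting the removed rows

module _ {A : Set} (f : A → ℕ) where

  length-filter-≤-suc : ∀ r xs →
    length (filter (λ x → f x ≤? suc r) xs)
      ≡ length (filter (λ x → f x ≤? r) xs) + length (filter (λ x → f x ≟ suc r) xs)
  length-filter-≤-suc r [] = refl
  length-filter-≤-suc r (x ∷ xs) with <-cmp (f x) (suc r)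
  ... | tri< fx<1+r fx≢1+r _
    rewrite filter-accept (λ x → f x ≤? suc r) {x} {xs} (<⇒≤ fx<1+r)
          | filter-accept (λ x → f x ≤? r) {x} {xs} (≤-pred fx<1+r)
          | filter-reject (λ x → f x ≟ suc r) {x} {xs} fx≢1+r
          = cong suc (length-filter-≤-suc r xs)
  ... | tri≈ fx≮1+r fx≡1+r _
    rewrite filter-accept (λ x → f x ≤? suc r) {x} {xs} (≤-reflexive fx≡1+r)
          | filter-reject (λ x → f x ≤? r) {x} {xs} (λ fx≤r → fx≮1+r (s≤s fx≤r))
          | filter-accept (λ x → f x ≟ suc r) {x} {xs} fx≡1+r
          = trans (cong suc (length-filter-≤-suc r xs)) (sym (+-suc _ _))
  ... | tri> _ fx≢1+r fx>1+r
    rewrite filter-reject (λ x → f x ≤? suc r) {x} {xs} (<⇒≱ fx>1+r)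
          | filter-reject (λ x → f x ≤? r) {x} {xs} (λ fx≤r → <⇒≱ fx>1+r (m≤n⇒m≤1+n fx≤r))
          | filter-reject (λ x → f x ≟ suc r) {x} {xs} fx≢1+r
          = length-filter-≤-suc r xs

  length-filter-≡ : (∀ x y → f x ≡ f y → x ≡ y) → ∀ v xs → Unique xs →
    length (filter (λ x → f x ≟ v) xs) ≡ 𝟙 (Any.any? (λ x → f x ≟ v) xs)
  length-filter-≡ f-inj v [] [] = refl
  length-filter-≡ f-inj v (x ∷ xs) (x∉xs ∷ xs!) with f x ≟ v
  ... | yes fx≡v
    rewrite filter-accept (λ x → f x ≟ v) {x} {xs} fx≡v
          | filter-none (λ x → f x ≟ v) (All.map (λ x≢y fy≡v → x≢y (f-inj _ _ (trans fx≡v (sym fy≡v)))) x∉xs)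
          = refl
  ... | no fx≢v
    rewrite filter-reject (λ x → f x ≟ v) {x} {xs} fx≢v
          = trans (length-filter-≡ f-inj v xs xs!)
                  (𝟙-cong (Any.any? (λ x → f x ≟ v) xs) _
                          (mk⇔ there λ { (here fx≡v) → contradiction fx≡v fx≢v ; (there p) → p }))

module RemovedRows {m : ℕ} (a : Fin m → ℕ) (increasing : ∀ i j → i F.< j → a i < a j) where

  a-injective : ∀ i j → a i ≡ a j → i ≡ j
  a-injective i j ai≡aj with FP.<-cmp i j
  ... | tri< i<j _ _ = contradiction ai≡aj (<⇒≢ (increasing i j i<j))
  ... | tri≈ _ i≡j _ = i≡j
  ... | tri> _ _ j<i = contradiction (sym ai≡aj) (<⇒≢ (increasing j i j<i))

  count≤ : ℕ → ℕ
  count≤ r = length (filter (λ i → a i ≤? r) (allFin m))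

  removed : ℕ → ℕ
  removed r = 𝟙 (FP.any? (λ i → a i ≟ r))

  removed-≤1 : ∀ r → removed r ≤ 1
  removed-≤1 r = 𝟙-≤1 (FP.any? (λ i → a i ≟ r))

  count≤-suc : ∀ r → count≤ (suc r) ≡ count≤ r + removed (suc r)
  count≤-suc r = begin
    count≤ (suc r)
      ≡⟨ length-filter-≤-suc a r (allFin m) ⟩
    count≤ r + length (filter (λ i → a i ≟ suc r) (allFin m))
      ≡⟨ cong (count≤ r +_) (length-filter-≡ a a-injective (suc r) (allFin m) (allFin⁺ m)) ⟩
    count≤ r + 𝟙 (Any.any? (λ i → a i ≟ suc r) (allFin m))
      ≡⟨ cong (count≤ r +_) (𝟙-cong (Any.any? (λ i → a i ≟ suc r) (allFin m)) (FP.any? (λ i → a i ≟ suc r))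
                                     (mk⇔ satisfied (λ (i , ai≡1+r) → lose (∈-allFin i) ai≡1+r))) ⟩
    count≤ r + removed (suc r)
      ∎
    where open ≡-Reasoning

  count≤-all : ∀ {n} → (∀ i → a i ≤ n) → count≤ n ≡ m
  count≤-all {n} a≤n = trans (cong length (filter-all (λ i → a i ≤? n) {allFin m} (All.tabulate (λ {i} _ → a≤n i))))
                             (length-tabulate (λ i → i))

  count≤-step : ∀ r → count≤ r ≤ count≤ (suc r)
  count≤-step r = subst (count≤ r ≤_) (sym (count≤-suc r)) (m≤m+n (count≤ r) (removed (suc r)))

  module _ (positive : ∀ i → 1 ≤ a i) where

    removed-0 : removed 0 ≡ 0
    removed-0 = 𝟙-no (FP.any? (λ i → a i ≟ 0)) (λ (i , ai≡0) → <⇒≢ (positive i) (sym ai≡0))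

    count≤-0 : count≤ 0 ≡ 0
    count≤-0 = cong length (filter-none (λ i → a i ≤? 0) {allFin m} (All.tabulate (λ {i} _ → <⇒≱ (positive i))))

    ∑-removed : ∀ n → ∑[ r < suc n ] removed r ≡ count≤ n
    ∑-removed zero    = trans removed-0 (sym count≤-0)
    ∑-removed (suc n) = trans (cong (_+ removed (suc n)) (∑-removed n)) (sym (count≤-suc n))

    module _ (bounded : ∀ t → 1 ≤ t → t ≤ m → count≤ (2 * t) ≤ t) where

      count≤-double : ∀ u → u ≤ m → count≤ (u + u) ≤ u
      count≤-double zero    _   = ≤-reflexive count≤-0
      count≤-double (suc w) u≤m =
        subst (λ k → count≤ k ≤ suc w) (cong (suc w +_) (+-identityʳ (suc w))) (bounded (suc w) (s≤s z≤n) u≤m)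

      balanced : ∀ r → suc r ≤ 2 * m → count≤ r + count≤ (suc r) ≤ suc r
      balanced r r+1≤2m with half r
      ... | u , inj₁ refl = begin
        count≤ (u + u) + count≤ (suc (u + u))                    ≡⟨ cong (count≤ (u + u) +_) (count≤-suc (u + u)) ⟩
        count≤ (u + u) + (count≤ (u + u) + removed (suc (u + u))) ≤⟨ +-mono-≤ C≤u (+-mono-≤ C≤u (removed-≤1 _)) ⟩
        u + (u + 1)                                               ≡⟨ cong (u +_) (+-comm u 1) ⟩
        u + suc u                                                 ≡⟨ +-suc u u ⟩
        suc (u + u)                                               ∎
        where
        open ≤-Reasoning
        C≤u = count≤-double u (m+m≤2*n⇒m≤n (≤-trans (n≤1+n _) r+1≤2m))
      ... | u , inj₂ refl = begin
        count≤ (suc (u + u)) + count≤ (suc (suc (u + u))) ≤⟨ +-mono-≤ (≤-trans (count≤-step _) C≤1+u) C≤1+u ⟩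
        suc u + suc u                                     ≡⟨ +-suc (suc u) u ⟩
        suc (suc (u + u))                                 ∎
        where
        open ≤-Reasoning
        C≤1+u : count≤ (suc (suc (u + u))) ≤ suc u
        C≤1+u = subst (λ k → count≤ k ≤ suc u) (cong suc (+-suc u u))
                  (count≤-double (suc u) (m+m≤2*n⇒m≤n (subst (_≤ 2 * m) (sym (cong suc (+-suc u u))) r+1≤2m)))

-- Lozenges, box sums and weights

covers-as-𝟙 : ∀ c l → covers c l ≡ 𝟙 (c ≟C proj₁ (cellsOf l)) + 𝟙 (c ≟C proj₂ (cellsOf l))
covers-as-𝟙 c ((d , e) , _) with c ≟C d | c ≟C e
... | yes _ | yes _ = refl
... | yes _ | no _  = refl
... | no _  | yes _ = refl
... | no _  | no _  = refl

coverCount-++ : ∀ c ls ls′ → coverCount c (ls ++ ls′) ≡ coverCount c ls + coverCount c ls′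
coverCount-++ c []       ls′ = refl
coverCount-++ c (l ∷ ls) ls′ = trans (cong (covers c l +_) (coverCount-++ c ls ls′)) (sym (+-assoc (covers c l) _ _))

boxSum : ℕ → (Cell → ℕ) → ℕ
boxSum B f = ∑[ r < B ] ∑[ j < B ] f (r , j)

InBox : ℕ → Cell → Set
InBox B (r , j) = r < B × j < B

boxSum-cong : ∀ B {f g : Cell → ℕ} → (∀ c → f c ≡ g c) → boxSum B f ≡ boxSum B g
boxSum-cong B f≗g = ∑-cong B (λ r _ → ∑-cong B (λ j _ → f≗g (r , j)))

boxSum-+ : ∀ B (f g : Cell → ℕ) → boxSum B (λ c → f c + g c) ≡ boxSum B f + boxSum B g
boxSum-+ B f g = trans (∑-cong B (λ r _ → ∑-+ B (λ j → f (r , j)) (λ j → g (r , j)))) (∑-+ B _ _)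

boxSum-zero : ∀ B {f : Cell → ℕ} → (∀ c → f c ≡ 0) → boxSum B f ≡ 0
boxSum-zero B f≗0 = ∑-zero B (λ r _ → ∑-zero B (λ j _ → f≗0 (r , j)))

boxSum-point : ∀ B (f : Cell → ℕ) c → InBox B c → (∀ d → d ≢ c → f d ≡ 0) → boxSum B f ≡ f c
boxSum-point B f (r₀ , j₀) (r₀<B , j₀<B) f≗0 =
  trans (∑-point B _ r₀ r₀<B (λ r r≢r₀ → ∑-zero B (λ j _ → f≗0 (r , j) (λ eq → r≢r₀ (cong proj₁ eq)))))
        (∑-point B _ j₀ j₀<B (λ j j≢j₀ → f≗0 (r₀ , j) (λ eq → j≢j₀ (cong proj₂ eq))))

boxSum-δ : ∀ B (f : Cell → ℕ) {P : Cell → Set} (P? : ∀ c → Dec (P c)) d → InBox B d →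
           (∀ c → P c ⇔ (c ≡ d)) → boxSum B (λ c → f c * 𝟙 (P? c)) ≡ f d
boxSum-δ B f P? d d∈B P⇔≡d = begin
  boxSum B (λ c → f c * 𝟙 (P? c))   ≡⟨ boxSum-point B _ d d∈B off-d ⟩
  f d * 𝟙 (P? d)                    ≡⟨ cong (f d *_) (𝟙-yes (P? d) (Equivalence.from (P⇔≡d d) refl)) ⟩
  f d * 1                           ≡⟨ *-identityʳ (f d) ⟩
  f d                               ∎
  where
  open ≡-Reasoning
  off-d : ∀ c → c ≢ d → f c * 𝟙 (P? c) ≡ 0
  off-d c c≢d = trans (cong (f c *_) (𝟙-no (P? c) (λ Pc → c≢d (Equivalence.to (P⇔≡d c) Pc)))) (*-zeroʳ (f c))

concatBelow : ∀ {A : Set} → ℕ → (ℕ → List A) → List A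
concatBelow zero    f = []
concatBelow (suc n) f = concatBelow n f ++ f n

boxConcat : ∀ {A : Set} → ℕ → (Cell → List A) → List A
boxConcat B f = concatBelow B (λ r → concatBelow B (λ j → f (r , j)))

coverCount-concatBelow : ∀ c n f → coverCount c (concatBelow n f) ≡ ∑[ i < n ] coverCount c (f i)
coverCount-concatBelow c zero    f = refl
coverCount-concatBelow c (suc n) f =
  trans (coverCount-++ c (concatBelow n f) (f n)) (cong (_+ coverCount c (f n)) (coverCount-concatBelow c n f))

coverCount-boxConcat : ∀ c B f → coverCount c (boxConcat B f) ≡ boxSum B (λ d → coverCount c (f d))
coverCount-boxConcat c B f = trans (coverCount-concatBelow c B _) (∑-cong B (λ r _ → coverCount-concatBelow c B _))

All-concatBelow : ∀ {A : Set} {P : A → Set} n f → (∀ i → All P (f i)) → All P (concatBelow n f)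
All-concatBelow zero    f all = []
All-concatBelow (suc n) f all = ++⁺ (All-concatBelow n f all) (all n)

All-boxConcat : ∀ {A : Set} {P : A → Set} B f → (∀ c → All P (f c)) → All P (boxConcat B f)
All-boxConcat B f all = All-concatBelow B _ (λ r → All-concatBelow B _ (λ j → all (r , j)))

lozengeWeight : (Cell → ℕ) → Lozenge → ℕ
lozengeWeight w l = w (proj₁ (cellsOf l)) + w (proj₂ (cellsOf l))

tilingWeight : (Cell → ℕ) → List Lozenge → ℕ
tilingWeight w []       = 0
tilingWeight w (l ∷ ls) = lozengeWeight w l + tilingWeight w ls

tilingWeight-mono : ∀ {v w} → (∀ l → lozengeWeight v l ≤ lozengeWeight w l) →
                    ∀ ls → tilingWeight v ls ≤ tilingWeight w ls
tilingWeight-mono v≤w []       = z≤n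
tilingWeight-mono v≤w (l ∷ ls) = +-mono-≤ (v≤w l) (tilingWeight-mono v≤w ls)

LozengeIn : (Cell → Set) → Lozenge → Set
LozengeIn R l = R (proj₁ (cellsOf l)) × R (proj₂ (cellsOf l))

boxSum-coverCount : ∀ B w ls → All (LozengeIn (InBox B)) ls →
                    boxSum B (λ c → w c * coverCount c ls) ≡ tilingWeight w ls
boxSum-coverCount B w [] [] = boxSum-zero B (λ c → *-zeroʳ (w c))
boxSum-coverCount B w (l@((d , e) , _) ∷ ls) ((d∈B , e∈B) ∷ ls∈B) = begin
  boxSum B (λ c → w c * coverCount c (l ∷ ls))
    ≡⟨ boxSum-cong B split ⟩
  boxSum B (λ c → w c * 𝟙 (c ≟C d) + w c * 𝟙 (c ≟C e) + w c * coverCount c ls)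
    ≡⟨ trans (boxSum-+ B _ _) (cong (_+ _) (boxSum-+ B _ _)) ⟩
  boxSum B (λ c → w c * 𝟙 (c ≟C d)) + boxSum B (λ c → w c * 𝟙 (c ≟C e)) + boxSum B (λ c → w c * coverCount c ls)
    ≡⟨ cong₂ _+_ (cong₂ _+_ (at d d∈B) (at e e∈B)) (boxSum-coverCount B w ls ls∈B) ⟩
  w d + w e + tilingWeight w ls
    ∎
  where
  open ≡-Reasoning
  split : ∀ c → w c * coverCount c (l ∷ ls) ≡ w c * 𝟙 (c ≟C d) + w c * 𝟙 (c ≟C e) + w c * coverCount c ls
  split c = begin
    w c * (covers c l + coverCount c ls)              ≡⟨ *-distribˡ-+ (w c) _ _ ⟩
    w c * covers c l + w c * coverCount c ls          ≡⟨ cong (λ k → w c * k + _) (covers-as-𝟙 c l) ⟩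
    w c * (𝟙 (c ≟C d) + 𝟙 (c ≟C e)) + _               ≡⟨ cong (_+ w c * coverCount c ls) (*-distribˡ-+ (w c) _ _) ⟩
    w c * 𝟙 (c ≟C d) + w c * 𝟙 (c ≟C e) + w c * coverCount c ls ∎
  at : ∀ d → InBox B d → boxSum B (λ c → w c * 𝟙 (c ≟C d)) ≡ w d
  at d d∈B = boxSum-δ B w (_≟C d) d d∈B (λ _ → ⇔.refl)

coverCount-outside : ∀ {R} c ls → All (LozengeIn R) ls → ¬ R c → coverCount c ls ≡ 0
coverCount-outside c []       []                 ¬Rc = refl
coverCount-outside c (l ∷ ls) ((Rd , Re) ∷ lsInR) ¬Rc =
  cong₂ _+_ (trans (covers-as-𝟙 c l) (cong₂ _+_ (𝟙-no (c ≟C proj₁ (cellsOf l)) (λ { refl → ¬Rc Rd }))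
                                              (𝟙-no (c ≟C proj₂ (cellsOf l)) (λ { refl → ¬Rc Re }))))
            (coverCount-outside c ls lsInR ¬Rc)

module _ {R : Cell → Set} (R? : ∀ c → Dec (R c)) where

  coverCount≡𝟙 : ∀ {ls} → IsTiling R ls → ∀ c → coverCount c ls ≡ 𝟙 (R? c)
  coverCount≡𝟙 {ls} (lsInR , once) c with R? c
  ... | yes Rc = once c Rc
  ... | no ¬Rc = coverCount-outside c ls lsInR ¬Rc

  tilingWeight-region : ∀ B w → (∀ c → R c → InBox B c) → ∀ {ls} → IsTiling R ls →
                        tilingWeight w ls ≡ boxSum B (λ c → w c * 𝟙 (R? c))
  tilingWeight-region B w R⊆B {ls} tiling@(lsInR , _) = begin
    tilingWeight w ls                          ≡⟨ boxSum-coverCount B w ls (All.map (λ (Rd , Re) → R⊆B _ Rd , R⊆B _ Re) lsInR) ⟨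
    boxSum B (λ c → w c * coverCount c ls)     ≡⟨ boxSum-cong B (λ c → cong (w c *_) (coverCount≡𝟙 tiling c)) ⟩
    boxSum B (λ c → w c * 𝟙 (R? c))            ∎
    where open ≡-Reasoning

boxSum-rows≤ : ∀ B n (f : Cell → ℕ) → n < B →
               boxSum B (λ (r , j) → 𝟙 (r ≤? n) * f (r , j)) ≡ ∑[ r < suc n ] ∑[ j < B ] f (r , j)
boxSum-rows≤ B n f n<B = begin
  boxSum B (λ (r , j) → 𝟙 (r ≤? n) * f (r , j))
    ≡⟨ ∑-cong B (λ r _ → ∑-*ˡ B (𝟙 (r ≤? n)) (λ j → f (r , j))) ⟩
  ∑[ r < B ] (𝟙 (r ≤? n) * ∑[ j < B ] f (r , j))
    ≡⟨ ∑-extend n<B (λ r n<r _ → cong (_* _) (𝟙-no (r ≤? n) (<⇒≱ n<r))) ⟩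
  ∑[ r < suc n ] (𝟙 (r ≤? n) * ∑[ j < B ] f (r , j))
    ≡⟨ ∑-cong (suc n) (λ r r≤n → trans (cong (_* _) (𝟙-yes (r ≤? n) (≤-pred r≤n))) (*-identityˡ _)) ⟩
  ∑[ r < suc n ] ∑[ j < B ] f (r , j)
    ∎
  where open ≡-Reasoning

verticalLozenge : ∀ r j → odd (j + r) ≡ false → Lozenge
verticalLozenge r j up = ((r , j) , (suc r , j)) , vert (odd⇒%2≡1 (j + suc r) (trans (odd-+suc j r) (cong not up)))

horizontalLozenge : ℕ → ℕ → Lozenge
horizontalLozenge r j = ((r , j) , (r , suc j)) , horiz

vertical-top-up : ∀ r j → (j + suc r) % 2 ≡ 1 → odd (j + r) ≡ false
vertical-top-up r j j+r+1-odd = Bool.not-injective (trans (cong odd (sym (+-suc j r))) (%2≡1⇒odd (j + suc r) j+r+1-odd))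

-- The region

module Region (x m : ℕ) {a : Fin m → ℕ} (increasing : ∀ i j → i F.< j → a i < a j) where

  open RemovedRows a increasing

  InQ′ : Cell → Set
  InQ′ (r , j) = 1 ≤ r × r ≤ 2 * m × 1 ≤ j × j + removed r ≤ 2 * x + r

  InQ⇔ : ∀ r j → InQ x m a (r , j) ⇔ InQ′ (r , j)
  InQ⇔ r j = mk⇔ to from
    where
    to : InQ x m a (r , j) → InQ′ (r , j)
    to (1≤r , r≤2m , 1≤j , j≤last , notLast) with FP.any? (λ i → a i ≟ r)
    ... | yes r∈a =
      1≤r , r≤2m , 1≤j , subst (_≤ 2 * x + r) (+-comm 1 j) (≤∧≢⇒< j≤last (λ j≡last → notLast (j≡last , r∈a)))
    ... | no _    = 1≤r , r≤2m , 1≤j , subst (_≤ 2 * x + r) (sym (+-identityʳ j)) j≤last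
    from : InQ′ (r , j) → InQ x m a (r , j)
    from (1≤r , r≤2m , 1≤j , j+e≤last) = 1≤r , r≤2m , 1≤j , ≤-trans (m≤m+n j _) j+e≤last , notLast
      where
      notLast : ¬ ((j ≡ 2 * x + r) × (r ∈Seq a))
      notLast (refl , r∈a) =
        1+n≰n (≤-trans (≤-reflexive (+-comm 1 j))
                       (subst (λ e → j + e ≤ j) (𝟙-yes (FP.any? (λ i → a i ≟ r)) r∈a) j+e≤last))

  InQ? : ∀ c → Dec (InQ x m a c)
  InQ? (r , j) = Dec.map (⇔.sym (InQ⇔ r j)) (1 ≤? r ×-dec r ≤? 2 * m ×-dec 1 ≤? j ×-dec j + removed r ≤? 2 * x + r)

  box : ℕ
  box = suc (2 * x + 2 * m)

  InQ⇒InBox : ∀ c → InQ x m a c → InBox box c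
  InQ⇒InBox (r , j) (_ , r≤2m , _ , j≤last , _) =
    s≤s (≤-trans r≤2m (m≤n+m (2 * m) (2 * x))) , s≤s (≤-trans j≤last (+-monoʳ-≤ (2 * x) r≤2m))

-- Necessity

▲ ▼ : Cell → ℕ
▲ (r , j) = bit (not (odd (j + r)))
▼ (r , j) = bit (odd (j + r))

ups downs : ℕ → ℕ → ℕ
ups   r L = ∑[ i < L ] ▲ (r , suc i)
downs r L = ∑[ i < L ] ▼ (r , suc i)

full-row-balance : ∀ x r → ups r (2 * x + r) ≡ downs r (2 * x + r) + bit (odd r)
full-row-balance x r with half r
... | k , inj₁ refl = begin
  ups r (2 * x + r)              ≡⟨ cong (ups r) (even-length x k) ⟩
  ups r (n + n)                  ≡⟨ ∑-alternating n _ (λ _ → refl) ⟩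
  n                              ≡⟨ ∑-alternating n _ (λ _ → refl) ⟨
  downs r (n + n)                ≡⟨ cong (downs r) (even-length x k) ⟨
  downs r (2 * x + r)            ≡⟨ +-identityʳ _ ⟨
  downs r (2 * x + r) + 0        ≡⟨ cong (λ b → downs r (2 * x + r) + bit b) even-r ⟨
  downs r (2 * x + r) + bit (odd r) ∎
  where
  open ≡-Reasoning
  n = x + k
  even-length : ∀ x k → 2 * x + (k + k) ≡ (x + k) + (x + k)
  even-length = solve-∀
  even-r : odd r ≡ false
  even-r = trans (cong odd (sym (+-identityʳ r))) (odd-double+ k 0)
... | k , inj₂ refl = begin
  ups r (2 * x + r)                                          ≡⟨ cong (ups r) (odd-length x k) ⟩
  ups r (n + n) + bit (not (odd (suc (n + n) + r)))
                                                             ≡⟨ cong₂ _+_ (∑-alternating n _ (λ _ → refl)) (cong (bit ∘ not) last-even) ⟩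
  n + 1                                                      ≡⟨ cong (_+ 1) (∑-alternating n _ (λ _ → refl)) ⟨
  downs r (n + n) + 1                                        ≡⟨ cong (_+ 1) (+-identityʳ (downs r (n + n))) ⟨
  downs r (n + n) + 0 + 1                                    ≡⟨ cong (λ b → downs r (n + n) + bit b + 1) last-even ⟨
  downs r (suc (n + n)) + 1                                  ≡⟨ cong₂ (λ L b → downs r L + bit b) (odd-length x k) odd-r ⟨
  downs r (2 * x + r) + bit (odd r)                          ∎
  where
  open ≡-Reasoning
  n = x + k
  odd-length : ∀ x k → 2 * x + suc (k + k) ≡ suc ((x + k) + (x + k))
  odd-length = solve-∀
  odd-r : odd r ≡ true
  odd-r = cong not (trans (cong odd (sym (+-identityʳ (k + k)))) (odd-double+ k 0))
  last-even : odd (suc (n + n) + r) ≡ false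
  last-even = trans (cong odd (shape x k)) (odd-double+ (suc (x + k + k)) 0)
    where
    shape : ∀ x k → suc ((x + k) + (x + k)) + suc (k + k) ≡ suc (x + k + k) + suc (x + k + k) + 0
    shape = solve-∀

row-balance : ∀ x r L e → e ≤ 1 → L + e ≡ 2 * x + r → ups r L + e ≡ downs r L + bit (odd r)
row-balance x r L zero _ L≡ rewrite +-identityʳ L | L≡ = trans (+-identityʳ _) (full-row-balance x r)
row-balance x r L (suc zero) _ L+1≡ = begin
  ups r L + 1                                            ≡⟨ cong (λ b → ups r L + bit (not b)) last-even ⟨
  ups r (suc L)                                          ≡⟨ cong (ups r) suc-L ⟩
  ups r (2 * x + r)                                      ≡⟨ full-row-balance x r ⟩
  downs r (2 * x + r) + bit (odd r)                      ≡⟨ cong (λ L → downs r L + bit (odd r)) suc-L ⟨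
  downs r L + bit (odd (suc L + r)) + bit (odd r)        ≡⟨ cong (λ b → downs r L + bit b + bit (odd r)) last-even ⟩
  downs r L + 0 + bit (odd r)                            ≡⟨ cong (_+ bit (odd r)) (+-identityʳ (downs r L)) ⟩
  downs r L + bit (odd r)                                ∎
  where
  open ≡-Reasoning
  suc-L : suc L ≡ 2 * x + r
  suc-L = trans (+-comm 1 L) L+1≡
  last-even : odd (suc L + r) ≡ false
  last-even = trans (cong (λ n → odd (n + r)) suc-L) (trans (cong odd (shape x r)) (odd-double+ (x + r) 0))
    where
    shape : ∀ x r → 2 * x + r + r ≡ (x + r) + (x + r) + 0
    shape = solve-∀
row-balance x r L (suc (suc _)) (s≤s ()) _

upWeight downWeight : ℕ → Cell → ℕ
upWeight   t c = 𝟙 (proj₁ c ≤? 2 * t) * ▲ c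
downWeight t c = 𝟙 (proj₁ c ≤? 2 * t) * ▼ c

-- The up triangle of a vertical lozenge lies above its down triangle, so truncating at row 2t
-- can only lose the down one.
downWeight≤upWeight : ∀ t l → lozengeWeight (downWeight t) l ≤ lozengeWeight (upWeight t) l
downWeight≤upWeight t (((r , j) , _) , horiz) with odd (j + r)
... | true  = ≤-reflexive (+-comm (𝟙 (r ≤? 2 * t) * 1) _)
... | false = ≤-reflexive (+-comm (𝟙 (r ≤? 2 * t) * 0) _)
downWeight≤upWeight t (((r , j) , _) , vert j+r+1-odd) with vertical-top-up r j j+r+1-odd
... | top-up rewrite +-suc j r | top-up = begin
    k r * 0 + k (suc r) * 1    ≡⟨ cong₂ _+_ (*-zeroʳ (k r)) (*-identityʳ (k (suc r))) ⟩
    k (suc r)                  ≤⟨ 𝟙-mono (suc r ≤? 2 * t) (r ≤? 2 * t) (λ 1+r≤2t → ≤-trans (n≤1+n r) 1+r≤2t) ⟩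
    k r                        ≡⟨ trans (cong₂ _+_ (*-identityʳ (k r)) (*-zeroʳ (k (suc r)))) (+-identityʳ (k r)) ⟨
    k r * 1 + k (suc r) * 0    ∎
  where
  open ≤-Reasoning
  k : ℕ → ℕ
  k r = 𝟙 (r ≤? 2 * t)

module Necessity (x m : ℕ) {a : Fin m → ℕ} (increasing : ∀ i j → i F.< j → a i < a j)
                 (positive : ∀ i → 1 ≤ a i) where

  open RemovedRows a increasing
  open Region x m increasing

  rowSum : (Cell → ℕ) → ℕ → ℕ
  rowSum f r = ∑[ j < box ] (f (r , j) * 𝟙 (InQ? (r , j)))

  rowSum-prefix : ∀ f {r L} → 1 ≤ r → r ≤ 2 * m → L + removed r ≡ 2 * x + r →
                  rowSum f r ≡ ∑[ i < L ] f (r , suc i)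
  rowSum-prefix f {r} {L} 1≤r r≤2m L+e≡ = ∑-interval (λ j → f (r , j)) (λ j → InQ? (r , j)) InQ-row L<box
    where
    InQ-row : ∀ j → InQ x m a (r , j) ⇔ (1 ≤ j × j ≤ L)
    InQ-row j = ⇔.trans (InQ⇔ r j) (mk⇔
      (λ (_ , _ , 1≤j , j+e≤) → 1≤j , +-cancelʳ-≤ (removed r) j L (subst (j + removed r ≤_) (sym L+e≡) j+e≤))
      (λ (1≤j , j≤L) → 1≤r , r≤2m , 1≤j , subst (j + removed r ≤_) L+e≡ (+-monoˡ-≤ (removed r) j≤L)))
    L<box : L < box
    L<box = s≤s (≤-trans (≤-trans (m≤m+n L (removed r)) (≤-reflexive L+e≡)) (+-monoʳ-≤ (2 * x) r≤2m))

  rowSum-balance : ∀ r → r ≤ 2 * m → rowSum ▲ r + removed r ≡ rowSum ▼ r + bit (odd r)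
  rowSum-balance zero _ = trans (cong₂ _+_ (empty ▲) (removed-0 positive)) (sym (cong (_+ 0) (empty ▼)))
    where
    empty : ∀ f → rowSum f 0 ≡ 0
    empty f = ∑-zero box (λ j _ → trans (cong (f (0 , j) *_) (𝟙-no (InQ? (0 , j)) (λ ()))) (*-zeroʳ (f (0 , j))))
  rowSum-balance r@(suc _) r≤2m = begin
    rowSum ▲ r + removed r    ≡⟨ cong (_+ removed r) (rowSum-prefix ▲ (s≤s z≤n) r≤2m L+e≡) ⟩
    ups r L + removed r       ≡⟨ row-balance x r L (removed r) (removed-≤1 r) L+e≡ ⟩
    downs r L + bit (odd r)   ≡⟨ cong (_+ bit (odd r)) (rowSum-prefix ▼ (s≤s z≤n) r≤2m L+e≡) ⟨
    rowSum ▼ r + bit (odd r)  ∎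
    where
    open ≡-Reasoning
    L = 2 * x + r ∸ removed r
    L+e≡ : L + removed r ≡ 2 * x + r
    L+e≡ = m∸n+n≡m (≤-trans (removed-≤1 r) (≤-trans (s≤s z≤n) (m≤n+m r (2 * x))))

  module _ {t : ℕ} (t≤m : t ≤ m) where

    2t<box : 2 * t < box
    2t<box = s≤s (≤-trans (*-monoʳ-≤ 2 t≤m) (m≤n+m (2 * m) (2 * x)))

    regionWeight : ∀ f → boxSum box (λ c → 𝟙 (proj₁ c ≤? 2 * t) * f c * 𝟙 (InQ? c)) ≡ ∑[ r < suc (2 * t) ] rowSum f r
    regionWeight f = trans (boxSum-cong box (λ c → *-assoc (𝟙 (proj₁ c ≤? 2 * t)) (f c) _))
                           (boxSum-rows≤ box (2 * t) (λ c → f c * 𝟙 (InQ? c)) 2t<box)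

    ∑-odd : ∑[ r < suc (2 * t) ] bit (odd r) ≡ t
    ∑-odd rewrite +-identityʳ t = trans (cong (_+ bit (odd (t + t))) (∑-alternating t odd (λ _ → refl)))
                                       (trans (cong (λ b → t + bit b) (trans (cong odd (sym (+-identityʳ (t + t)))) (odd-double+ t 0)))
                                              (+-identityʳ t))

    count-balance : ∑[ r < suc (2 * t) ] rowSum ▲ r + count≤ (2 * t) ≡ ∑[ r < suc (2 * t) ] rowSum ▼ r + t
    count-balance = begin
      ∑[ r < suc (2 * t) ] rowSum ▲ r + count≤ (2 * t)
        ≡⟨ cong (∑[ r < suc (2 * t) ] rowSum ▲ r +_) (∑-removed positive (2 * t)) ⟨
      ∑[ r < suc (2 * t) ] rowSum ▲ r + ∑[ r < suc (2 * t) ] removed r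
        ≡⟨ ∑-+ (suc (2 * t)) _ _ ⟨
      ∑[ r < suc (2 * t) ] (rowSum ▲ r + removed r)
        ≡⟨ ∑-cong (suc (2 * t)) (λ r r≤2t → rowSum-balance r (≤-trans (≤-pred r≤2t) (*-monoʳ-≤ 2 t≤m))) ⟩
      ∑[ r < suc (2 * t) ] (rowSum ▼ r + bit (odd r))
        ≡⟨ ∑-+ (suc (2 * t)) _ _ ⟩
      ∑[ r < suc (2 * t) ] rowSum ▼ r + ∑[ r < suc (2 * t) ] bit (odd r)
        ≡⟨ cong (∑[ r < suc (2 * t) ] rowSum ▼ r +_) ∑-odd ⟩
      ∑[ r < suc (2 * t) ] rowSum ▼ r + t
        ∎
      where open ≡-Reasoning

    tileable⇒count≤ : Tileable (InQ x m a) → count≤ (2 * t) ≤ t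
    tileable⇒count≤ (ls , tiling) = +-cancelˡ-≤ ▼s _ _ (begin
      ▼s + count≤ (2 * t)  ≤⟨ +-monoˡ-≤ (count≤ (2 * t)) ▼s≤▲s ⟩
      ▲s + count≤ (2 * t)  ≡⟨ count-balance ⟩
      ▼s + t               ∎)
      where
      open ≤-Reasoning
      ▲s ▼s : ℕ
      ▲s = ∑[ r < suc (2 * t) ] rowSum ▲ r
      ▼s = ∑[ r < suc (2 * t) ] rowSum ▼ r
      weight≡ : ∀ f → tilingWeight (λ c → 𝟙 (proj₁ c ≤? 2 * t) * f c) ls ≡ ∑[ r < suc (2 * t) ] rowSum f r
      weight≡ f = trans (tilingWeight-region InQ? box _ InQ⇒InBox tiling) (regionWeight f)
      ▼s≤▲s : ▼s ≤ ▲s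
      ▼s≤▲s = begin
        ▼s                              ≡⟨ weight≡ ▼ ⟨
        tilingWeight (downWeight t) ls  ≤⟨ tilingWeight-mono (downWeight≤upWeight t) ls ⟩
        tilingWeight (upWeight t) ls    ≡⟨ weight≡ ▲ ⟩
        ▲s                              ∎

-- Sufficiency

zone-shape : ∀ j p e₁ e₀ → j + ((p + e₁) + ((p + e₁) + e₀)) ≡ j + (p + (p + e₁)) + (e₁ + e₀)
zone-shape = solve-∀

-- In the next two lemmas p + (p + e₁) and (p + e₁) + ((p + e₁) + e₀) stand for σ n and σ (n + 1),
-- where p = |{a_i} ∩ [n − 1]| and e₁, e₀ record whether n and n + 1 are among the a_i.
up-in-zone⇒below-in-zone : ∀ j n p e₁ e₀ → e₁ ≤ 1 → e₀ ≤ 1 →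
  j + (p + (p + e₁)) ≤ n → odd (j + n) ≡ false → j + ((p + e₁) + ((p + e₁) + e₀)) ≤ suc n
up-in-zone⇒below-in-zone j n p e₁ e₀ e₁≤1 e₀≤1 q≤n up rewrite zone-shape j p e₁ e₀ = step e₁ e₀ e₁≤1 e₀≤1 q≤n up
  where
  step : ∀ e₁ e₀ → e₁ ≤ 1 → e₀ ≤ 1 → j + (p + (p + e₁)) ≤ n → odd (j + n) ≡ false →
         j + (p + (p + e₁)) + (e₁ + e₀) ≤ suc n
  step zero e₀ _ e₀≤1 q≤n _ = ≤-trans (+-mono-≤ q≤n e₀≤1) (≤-reflexive (+-comm n 1))
  step (suc zero) zero _ _ q≤n _ = ≤-trans (+-monoˡ-≤ 1 q≤n) (≤-reflexive (+-comm n 1))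
  step (suc zero) (suc zero) _ _ q≤n up = ≤-trans (≤-reflexive (+-comm q 2)) (s≤s (≤∧≢⇒< q≤n q≢n))
    where
    q = j + (p + (p + 1))
    q≢n : q ≢ n
    q≢n refl = true≢false (trans (sym (trans (cong odd (odd-shape j p)) (odd-double+ (j + p) 1))) up)
      where
      odd-shape : ∀ j p → j + (j + (p + (p + 1))) ≡ (j + p) + (j + p) + 1
      odd-shape = solve-∀
  step (suc (suc _)) _ (s≤s ()) _ _ _
  step (suc zero) (suc (suc _)) _ (s≤s ()) _ _

down-in-zone⇒above-in-zone : ∀ j n p e₁ e₀ →
  j + ((p + e₁) + ((p + e₁) + e₀)) ≤ suc n → odd (j + suc n) ≡ true → j + (p + (p + e₁)) ≤ n
down-in-zone⇒above-in-zone j n p e₁ e₀ q+d≤1+n down rewrite zone-shape j p e₁ e₀ = step e₁ e₀ q+d≤1+n down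
  where
  grown : ∀ {q d} → 1 ≤ d → q + d ≤ suc n → q ≤ n
  grown {q} 1≤d q+d≤1+n = ≤-pred (≤-trans (≤-trans (≤-reflexive (+-comm 1 q)) (+-monoʳ-≤ q 1≤d)) q+d≤1+n)
  step : ∀ e₁ e₀ → j + (p + (p + e₁)) + (e₁ + e₀) ≤ suc n → odd (j + suc n) ≡ true → j + (p + (p + e₁)) ≤ n
  step (suc e₁) e₀       q+d≤1+n _ = grown (s≤s z≤n) q+d≤1+n
  step zero    (suc e₀) q+d≤1+n _ = grown (s≤s z≤n) q+d≤1+n
  step zero    zero     q+0≤1+n down with m≤n⇒m<n∨m≡n (subst (_≤ suc n) (+-identityʳ _) q+0≤1+n)
  ... | inj₁ q<1+n = ≤-pred q<1+n
  ... | inj₂ q≡1+n = contradiction (trans (sym down) (trans (cong (λ k → odd (j + k)) (sym q≡1+n))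
                                      (trans (cong odd (even-shape j p)) (odd-double+ (j + p) 0)))) true≢false
    where
    even-shape : ∀ j p → j + (j + (p + (p + 0))) ≡ (j + p) + (j + p) + 0
    even-shape = solve-∀

zone-of-last-row : ∀ j s e → e ≤ 1 → 1 ≤ j → j + s ≤ s + e → j ≡ 1
zone-of-last-row j s e e≤1 1≤j j+s≤s+e = ≤-antisym (≤-trans (+-cancelʳ-≤ s j e (subst (j + s ≤_) (+-comm s e) j+s≤s+e)) e≤1) 1≤j

horizontal-fits : ∀ x r j c e → odd (j + r + (c + (c + e))) ≡ true → j + e ≤ 2 * x + r → suc j + e ≤ 2 * x + r
horizontal-fits x r j c e odd-start j+e≤ = ≤∧≢⇒< j+e≤ j+e≢
  where
  j+e≢ : j + e ≢ 2 * x + r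
  j+e≢ j+e≡ = true≢false (begin
    true                          ≡⟨ odd-start ⟨
    odd (j + r + (c + (c + e)))   ≡⟨ cong odd (shape j r c e) ⟩
    odd (c + c + (j + e + r))     ≡⟨ odd-double+ c (j + e + r) ⟩
    odd (j + e + r)               ≡⟨ cong (λ k → odd (k + r)) j+e≡ ⟩
    odd (2 * x + r + r)           ≡⟨ cong odd (even x r) ⟩
    odd ((x + r) + (x + r) + 0)   ≡⟨ odd-double+ (x + r) 0 ⟩
    false                         ∎)
    where
    open ≡-Reasoning
    shape : ∀ j r c e → j + r + (c + (c + e)) ≡ c + c + (j + e + r)
    shape = solve-∀
    even : ∀ x r → 2 * x + r + r ≡ (x + r) + (x + r) + 0
    even = solve-∀

left-partner : ∀ r j s → r < suc j + s → odd (suc j + r + s) ≡ false → s ≤ r → 1 ≤ j × r < j + s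
left-partner r j s r<1+j+s even-start s≤r with m≤n⇒m<n∨m≡n (≤-pred r<1+j+s)
... | inj₂ r≡j+s = contradiction (trans (sym odd-start) even-start) true≢false
  where
  odd-start : odd (suc j + r + s) ≡ true
  odd-start = trans (cong (λ k → odd (suc j + k + s)) r≡j+s)
                    (cong not (trans (cong odd (shape j s)) (odd-double+ (j + s) 0)))
    where
    shape : ∀ j s → j + (j + s) + s ≡ (j + s) + (j + s) + 0
    shape = solve-∀
... | inj₁ r<j+s with j
...   | zero  = contradiction s≤r (<⇒≱ r<j+s)
...   | suc _ = s≤s z≤n , r<j+s

𝟙-partition : ∀ {ℓ} {Z : Set ℓ} (Z? : Dec Z) (u h : Bool) →
  𝟙 (Z? ×-dec u Bool.≟ false) + 𝟙 (Z? ×-dec u Bool.≟ true)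
    + (𝟙 (¬? Z? ×-dec h Bool.≟ true) + 𝟙 (¬? Z? ×-dec h Bool.≟ false)) ≡ 1
𝟙-partition (yes _) true  _     = refl
𝟙-partition (yes _) false _     = refl
𝟙-partition (no _)  _     true  = refl
𝟙-partition (no _)  _     false = refl

module Construction (x m : ℕ) {a : Fin m → ℕ} (increasing : ∀ i j → i F.< j → a i < a j) where

  open RemovedRows a increasing
  open Region x m increasing

  -- Row r is cut after column r − σ r: the cells (r , j) with j + σ r ≤ r form its vertical zone,
  -- whose up triangles start vertical lozenges; the rest of the row is covered by horizontal ones
  -- starting at every other column from the cut onwards.
  σ : ℕ → ℕ
  σ r = count≤ (pred r) + count≤ r

  σ-suc : ∀ r → σ (suc r) ≡ count≤ r + (count≤ r + removed (suc r))
  σ-suc r = cong (count≤ r +_) (count≤-suc r)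

  InZone : Cell → Set
  InZone (r , j) = j + σ r ≤ r

  Vertical Horizontal : Cell → Set
  Vertical   (r , j) = 1 ≤ r × 1 ≤ j × suc r ≤ 2 * m × odd (j + r) ≡ false × InZone (r , j)
  Horizontal (r , j) = 1 ≤ r × r ≤ 2 * m × 1 ≤ j × r < j + σ r × suc j + removed r ≤ 2 * x + r × odd (j + r + σ r) ≡ true

  InZone? : ∀ c → Dec (InZone c)
  InZone? (r , j) = j + σ r ≤? r

  Vertical? : ∀ c → Dec (Vertical c)
  Vertical? (r , j) = 1 ≤? r ×-dec 1 ≤? j ×-dec suc r ≤? 2 * m ×-dec odd (j + r) Bool.≟ false ×-dec InZone? (r , j)
  Horizontal? : ∀ c → Dec (Horizontal c)
  Horizontal? (r , j) = 1 ≤? r ×-dec r ≤? 2 * m ×-dec 1 ≤? j ×-dec suc r ≤? j + σ r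
                        ×-dec suc j + removed r ≤? 2 * x + r ×-dec odd (j + r + σ r) Bool.≟ true

  verticalAt horizontalAt : Cell → List Lozenge
  verticalAt (r , j) with Vertical? (r , j)
  ... | yes (_ , _ , _ , up , _) = verticalLozenge r j up ∷ []
  ... | no _ = []
  horizontalAt (r , j) with Horizontal? (r , j)
  ... | yes _ = horizontalLozenge r j ∷ []
  ... | no _  = []

  tiling : List Lozenge
  tiling = boxConcat box (λ c → verticalAt c ++ horizontalAt c)

  coverCount-verticalAt : ∀ c r j →
    coverCount c (verticalAt (r , j)) ≡ 𝟙 (Vertical? (r , j)) * (𝟙 (c ≟C (r , j)) + 𝟙 (c ≟C (suc r , j)))
  coverCount-verticalAt c r j with Vertical? (r , j)
  ... | yes (_ , _ , _ , up , _) = cong (_+ 0) (covers-as-𝟙 c (verticalLozenge r j up))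
  ... | no _  = refl

  coverCount-horizontalAt : ∀ c r j →
    coverCount c (horizontalAt (r , j)) ≡ 𝟙 (Horizontal? (r , j)) * (𝟙 (c ≟C (r , j)) + 𝟙 (c ≟C (r , suc j)))
  coverCount-horizontalAt c r j with Horizontal? (r , j)
  ... | yes _ = cong (_+ 0) (covers-as-𝟙 c (horizontalLozenge r j))
  ... | no _  = refl

  coverCount-verticals : ∀ r j → InBox box (suc r , suc j) →
    boxSum box (λ d → coverCount (suc r , suc j) (verticalAt d))
      ≡ 𝟙 (Vertical? (suc r , suc j)) + 𝟙 (Vertical? (r , suc j))
  coverCount-verticals r j c∈box@(1+r<box , 1+j<box) = begin
    boxSum box (λ d → coverCount c (verticalAt d))
      ≡⟨ boxSum-cong box (λ (r′ , j′) → trans (coverCount-verticalAt c r′ j′)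
                                               (*-distribˡ-+ (𝟙 (Vertical? (r′ , j′))) (𝟙 (c ≟C (r′ , j′))) _)) ⟩
    boxSum box (λ (r′ , j′) → 𝟙 (Vertical? (r′ , j′)) * 𝟙 (c ≟C (r′ , j′))
                            + 𝟙 (Vertical? (r′ , j′)) * 𝟙 (c ≟C (suc r′ , j′)))
      ≡⟨ boxSum-+ box _ _ ⟩
    boxSum box (λ d → 𝟙 (Vertical? d) * 𝟙 (c ≟C d))
    + boxSum box (λ (r′ , j′) → 𝟙 (Vertical? (r′ , j′)) * 𝟙 (c ≟C (suc r′ , j′)))
      ≡⟨ cong₂ _+_ (boxSum-δ box (λ d → 𝟙 (Vertical? d)) (c ≟C_) c c∈box (λ _ → mk⇔ sym sym))
                   (boxSum-δ box (λ d → 𝟙 (Vertical? d)) (λ (r′ , j′) → c ≟C (suc r′ , j′)) (r , suc j)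
                             (≤-trans (n≤1+n _) 1+r<box , 1+j<box) (λ _ → mk⇔ (λ { refl → refl }) (λ { refl → refl }))) ⟩
    𝟙 (Vertical? c) + 𝟙 (Vertical? (r , suc j))
      ∎
    where
    open ≡-Reasoning
    c = (suc r , suc j)

  coverCount-horizontals : ∀ r j → InBox box (suc r , suc j) →
    boxSum box (λ d → coverCount (suc r , suc j) (horizontalAt d))
      ≡ 𝟙 (Horizontal? (suc r , suc j)) + 𝟙 (Horizontal? (suc r , j))
  coverCount-horizontals r j c∈box@(1+r<box , 1+j<box) = begin
    boxSum box (λ d → coverCount c (horizontalAt d))
      ≡⟨ boxSum-cong box (λ (r′ , j′) → trans (coverCount-horizontalAt c r′ j′)
                                               (*-distribˡ-+ (𝟙 (Horizontal? (r′ , j′))) (𝟙 (c ≟C (r′ , j′))) _)) ⟩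
    boxSum box (λ (r′ , j′) → 𝟙 (Horizontal? (r′ , j′)) * 𝟙 (c ≟C (r′ , j′))
                            + 𝟙 (Horizontal? (r′ , j′)) * 𝟙 (c ≟C (r′ , suc j′)))
      ≡⟨ boxSum-+ box _ _ ⟩
    boxSum box (λ d → 𝟙 (Horizontal? d) * 𝟙 (c ≟C d))
    + boxSum box (λ (r′ , j′) → 𝟙 (Horizontal? (r′ , j′)) * 𝟙 (c ≟C (r′ , suc j′)))
      ≡⟨ cong₂ _+_ (boxSum-δ box (λ d → 𝟙 (Horizontal? d)) (c ≟C_) c c∈box (λ _ → mk⇔ sym sym))
                   (boxSum-δ box (λ d → 𝟙 (Horizontal? d)) (λ (r′ , j′) → c ≟C (r′ , suc j′)) (suc r , j)
                             (1+r<box , ≤-trans (n≤1+n _) 1+j<box) (λ _ → mk⇔ (λ { refl → refl }) (λ { refl → refl }))) ⟩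
    𝟙 (Horizontal? c) + 𝟙 (Horizontal? (suc r , j))
      ∎
    where
    open ≡-Reasoning
    c = (suc r , suc j)

  coverCount-tiling : ∀ r j → InBox box (suc r , suc j) →
    coverCount (suc r , suc j) tiling
      ≡ 𝟙 (Vertical? (suc r , suc j)) + 𝟙 (Vertical? (r , suc j))
        + (𝟙 (Horizontal? (suc r , suc j)) + 𝟙 (Horizontal? (suc r , j)))
  coverCount-tiling r j c∈box = begin
    coverCount c tiling
      ≡⟨ coverCount-boxConcat c box _ ⟩
    boxSum box (λ d → coverCount c (verticalAt d ++ horizontalAt d))
      ≡⟨ trans (boxSum-cong box (λ d → coverCount-++ c (verticalAt d) (horizontalAt d))) (boxSum-+ box _ _) ⟩
    boxSum box (λ d → coverCount c (verticalAt d)) + boxSum box (λ d → coverCount c (horizontalAt d))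
      ≡⟨ cong₂ _+_ (coverCount-verticals r j c∈box) (coverCount-horizontals r j c∈box) ⟩
    𝟙 (Vertical? c) + 𝟙 (Vertical? (r , suc j)) + (𝟙 (Horizontal? c) + 𝟙 (Horizontal? (suc r , j)))
      ∎
    where
    open ≡-Reasoning
    c = (suc r , suc j)

  removed≤σ : ∀ r → 1 ≤ r → removed r ≤ σ r
  removed≤σ (suc r) _ = subst (removed (suc r) ≤_) (sym (σ-suc r)) (≤-trans (m≤n+m _ (count≤ r)) (m≤n+m _ (count≤ r)))

  verticalAt-in-Q : ∀ d → All (LozengeIn (InQ x m a)) (verticalAt d)
  verticalAt-in-Q (r , j) with Vertical? (r , j)
  ... | no _ = []
  ... | yes (1≤r , 1≤j , 1+r≤2m , _ , in-zone) = (top , bottom) ∷ []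
    where
    j≤r : j ≤ r
    j≤r = ≤-trans (m≤m+n j (σ r)) in-zone
    top : InQ x m a (r , j)
    top = Equivalence.from (InQ⇔ r j)
            (1≤r , ≤-trans (n≤1+n r) 1+r≤2m , 1≤j ,
             ≤-trans (+-monoʳ-≤ j (removed≤σ r 1≤r)) (≤-trans in-zone (m≤n+m r (2 * x))))
    bottom : InQ x m a (suc r , j)
    bottom = Equivalence.from (InQ⇔ (suc r) j)
               (s≤s z≤n , 1+r≤2m , 1≤j ,
                ≤-trans (+-mono-≤ j≤r (removed-≤1 (suc r))) (≤-trans (≤-reflexive (+-comm r 1)) (m≤n+m (suc r) (2 * x))))

  horizontalAt-in-Q : ∀ d → All (LozengeIn (InQ x m a)) (horizontalAt d)
  horizontalAt-in-Q (r , j) with Horizontal? (r , j)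
  ... | no _ = []
  ... | yes (1≤r , r≤2m , 1≤j , _ , fits , _) =
    (Equivalence.from (InQ⇔ r j) (1≤r , r≤2m , 1≤j , ≤-trans (n≤1+n _) fits) ,
     Equivalence.from (InQ⇔ r (suc j)) (1≤r , r≤2m , s≤s z≤n , fits)) ∷ []

  tiling-in-Q : All (LozengeIn (InQ x m a)) tiling
  tiling-in-Q = All-boxConcat box _ (λ d → ++⁺ (verticalAt-in-Q d) (horizontalAt-in-Q d))

  σ-suc-suc : ∀ r → σ (suc (suc r)) ≡ (count≤ r + removed (suc r)) + ((count≤ r + removed (suc r)) + removed (suc (suc r)))
  σ-suc-suc r = trans (σ-suc (suc r)) (cong (λ c → c + (c + removed (suc (suc r)))) (count≤-suc r))

  σ+removed : ∀ r → σ (suc r) + removed (suc r) ≡ count≤ (suc r) + count≤ (suc r)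
  σ+removed r = trans (cong (_+ removed (suc r)) (σ-suc r))
                      (trans (regroup (count≤ r) (removed (suc r))) (cong (λ c → c + c) (sym (count≤-suc r))))
    where
    regroup : ∀ c e → c + (c + e) + e ≡ (c + e) + (c + e)
    regroup = solve-∀

  module _ (count≤-2m : count≤ (2 * m) ≡ m)
           (balanced : ∀ r → suc r ≤ 2 * m → count≤ r + count≤ (suc r) ≤ suc r) where

    vertical-here : ∀ r j → suc r ≤ 2 * m →
                    Vertical (suc r , suc j) ⇔ (InZone (suc r , suc j) × odd (suc j + suc r) ≡ false)
    vertical-here r j r+1≤2m = mk⇔
      (λ (_ , _ , _ , up , in-zone) → in-zone , up)
      (λ (in-zone , up) → s≤s z≤n , s≤s z≤n , ≤∧≢⇒< r+1≤2m (not-last in-zone up) , up , in-zone)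
      where
      not-last : InZone (suc r , suc j) → odd (suc j + suc r) ≡ false → suc r ≢ 2 * m
      not-last in-zone up r+1≡2m = true≢false (begin
        true                 ≡⟨ cong not (odd-2* m) ⟨
        not (odd (2 * m))    ≡⟨ cong (not ∘ odd) r+1≡2m ⟨
        odd (1 + suc r)      ≡⟨ cong (λ j → odd (j + suc r)) j≡1 ⟨
        odd (suc j + suc r)  ≡⟨ up ⟩
        false                ∎)
        where
        open ≡-Reasoning
        σ+e≡2m : σ (suc r) + removed (suc r) ≡ 2 * m
        σ+e≡2m = trans (σ+removed r) (trans (cong (λ k → count≤ k + count≤ k) r+1≡2m)
                                      (trans (cong (λ c → c + c) count≤-2m) (cong (m +_) (sym (+-identityʳ m)))))
        j≡1 : suc j ≡ 1
        j≡1 = zone-of-last-row (suc j) (σ (suc r)) (removed (suc r)) (removed-≤1 _) (s≤s z≤n)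
                (≤-trans in-zone (≤-reflexive (trans r+1≡2m (sym σ+e≡2m))))

    vertical-above : ∀ r j → suc r ≤ 2 * m →
                     Vertical (r , suc j) ⇔ (InZone (suc r , suc j) × odd (suc j + suc r) ≡ true)
    vertical-above zero zero    _ = mk⇔ (λ { (() , _) }) (λ { (_ , ()) })
    vertical-above zero (suc j) _ = mk⇔ (λ { (() , _) }) (λ { (s≤s () , _) })
    vertical-above (suc r) j r+2≤2m = mk⇔
      (λ (_ , _ , _ , up , in-zone) →
        subst (λ s → suc j + s ≤ suc (suc r)) (sym (σ-suc-suc r))
          (up-in-zone⇒below-in-zone (suc j) (suc r) (count≤ r) (removed (suc r)) (removed (suc (suc r)))
            (removed-≤1 _) (removed-≤1 _) (subst (λ s → suc j + s ≤ suc r) (σ-suc r) in-zone) up) ,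
        trans (odd-+suc (suc j) (suc r)) (cong not up))
      (λ (in-zone , down) →
        s≤s z≤n , s≤s z≤n , r+2≤2m , Bool.not-injective (trans (sym (odd-+suc (suc j) (suc r))) down) ,
        subst (λ s → suc j + s ≤ suc r) (sym (σ-suc r))
          (down-in-zone⇒above-in-zone (suc j) (suc r) (count≤ r) (removed (suc r)) (removed (suc (suc r)))
            (subst (λ s → suc j + s ≤ suc (suc r)) (σ-suc-suc r) in-zone) down))

    horizontal-here : ∀ r j → suc r ≤ 2 * m → suc j + removed (suc r) ≤ 2 * x + suc r →
                      Horizontal (suc r , suc j) ⇔ (¬ InZone (suc r , suc j) × odd (suc j + suc r + σ (suc r)) ≡ true)
    horizontal-here r j r+1≤2m fits = mk⇔
      (λ (_ , _ , _ , outside , _ , odd-start) → <⇒≱ outside , odd-start)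
      (λ (outside , odd-start) →
        s≤s z≤n , r+1≤2m , s≤s z≤n , ≰⇒> outside ,
        horizontal-fits x (suc r) (suc j) (count≤ r) (removed (suc r))
          (subst (λ s → odd (suc j + suc r + s) ≡ true) (σ-suc r) odd-start) fits ,
        odd-start)

    horizontal-left : ∀ r j → suc r ≤ 2 * m → suc j + removed (suc r) ≤ 2 * x + suc r →
                      Horizontal (suc r , j) ⇔ (¬ InZone (suc r , suc j) × odd (suc j + suc r + σ (suc r)) ≡ false)
    horizontal-left r j r+1≤2m fits = mk⇔
      (λ (_ , _ , _ , outside , _ , odd-start) → <⇒≱ (≤-trans outside (n≤1+n _)) , cong not odd-start)
      (λ (outside , even-start) →
        let 1≤j , outside′ = left-partner (suc r) j (σ (suc r)) (≰⇒> outside) even-start (balanced r r+1≤2m)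
        in s≤s z≤n , r+1≤2m , 1≤j , outside′ , fits , Bool.not-injective even-start)

    -- A cell in the vertical zone is covered by the vertical lozenge at it or at the cell above,
    -- according to its orientation; a cell outside it by the horizontal lozenge at it or at its
    -- left neighbour, according to the parity of its distance to the cut.
    cover-once : ∀ c → InQ x m a c → coverCount c tiling ≡ 1
    cover-once (zero  , _    ) (() , _)
    cover-once (suc r , zero ) (_ , _ , () , _)
    cover-once c@(suc r , suc j) c∈Q with Equivalence.to (InQ⇔ (suc r) (suc j)) c∈Q
    ... | _ , r+1≤2m , _ , fits = begin
      coverCount c tiling
        ≡⟨ coverCount-tiling r j (InQ⇒InBox c c∈Q) ⟩
      𝟙 (Vertical? c) + 𝟙 (Vertical? (r , suc j)) + (𝟙 (Horizontal? c) + 𝟙 (Horizontal? (suc r , j)))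
        ≡⟨ cong₂ _+_ (cong₂ _+_ (𝟙-cong (Vertical? c) (Z ×-dec _) (vertical-here r j r+1≤2m))
                                (𝟙-cong (Vertical? (r , suc j)) (Z ×-dec _) (vertical-above r j r+1≤2m)))
                     (cong₂ _+_ (𝟙-cong (Horizontal? c) (¬? Z ×-dec _) (horizontal-here r j r+1≤2m fits))
                                (𝟙-cong (Horizontal? (suc r , j)) (¬? Z ×-dec _) (horizontal-left r j r+1≤2m fits))) ⟩
      𝟙 (Z ×-dec odd (suc j + suc r) Bool.≟ false) + 𝟙 (Z ×-dec odd (suc j + suc r) Bool.≟ true)
        + (𝟙 (¬? Z ×-dec odd (suc j + suc r + σ (suc r)) Bool.≟ true)
           + 𝟙 (¬? Z ×-dec odd (suc j + suc r + σ (suc r)) Bool.≟ false))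
        ≡⟨ 𝟙-partition Z (odd (suc j + suc r)) (odd (suc j + suc r + σ (suc r))) ⟩
      1 ∎
      where
      open ≡-Reasoning
      Z = InZone? c

    Q-tileable : Tileable (InQ x m a)
    Q-tileable = tiling , tiling-in-Q , cover-once

lemma2p2 : (x m : ℕ) (a : Fin m → ℕ)
    → (∀ i → (1 ≤ a i) × (a i ≤ 2 * m))
    → (∀ i j → i F.< j → a i < a j)
    → Tileable (InQ x m a) ⇔ (∀ t → 1 ≤ t → t ≤ m → countUpTo a t ≤ t)
lemma2p2 x m a bounds increasing = mk⇔
  (λ tileable t _ t≤m → Necessity.tileable⇒count≤ x m increasing positive t≤m tileable)
  (λ bounded → Construction.Q-tileable x m increasing (count≤-all (proj₂ ∘ bounds)) (balanced positive bounded))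
  where
  open RemovedRows a increasing
  positive : ∀ i → 1 ≤ a i
  positive = proj₁ ∘ bounds
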